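{- Let $S$ and $T$ be monads on $\mathsf{Set}$ and let $\lambda \colon TS \Rightarrow ST$ be a natural transformation. Then $$\rho^S T \circ S\rho^T \circ \lambda R = R\lambda \circ \rho^T S \circ T\rho^S,$$ where $R$ is the reader monad and $\rho^S,\rho^T$ are defined below.
   Context: Fix a set $A$. The reader monad $R$ on $\mathsf{Set}$: $RX = X^A$, $Rf(h) = f\circ h$, $\eta^R_X(x) = (a \mapsto x)$, $\mu^R_X(h) = (a \mapsto h(a)(a))$. For $a \in A$, $\hat{a}_X \colon RX \to X$ is $\hat a_X(h) = h(a)$. For a monad $T$ on $\mathsf{Set}$, $\rho^T \colon TR \Rightarrow RT$ is defined by $\rho^T_X(z) = (a \mapsto T\hat{a}_X(z))$ for $z \in TRX$. -}

module Defs where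

open import Level using (Level; suc; _⊔_)
open import Function using (_∘_; id)
open import Relation.Binary.PropositionalEquality using (_≡_)

-- Pointwise equality of functions (no function extensionality in --safe Agda).
infix 4 _≗_
_≗_ : ∀ {a b} {X : Set a} {Y : Set b} → (X → Y) → (X → Y) → Set (a ⊔ b)
f ≗ g = ∀ x → f x ≡ g x

record Monad (ℓ : Level) : Set (suc ℓ) where
  field
    F      : Set ℓ → Set ℓ
    fmap   : ∀ {X Y : Set ℓ} → (X → Y) → F X → F Y
    fmap-cong : ∀ {X Y : Set ℓ} {f g : X → Y} → f ≗ g → fmap f ≗ fmap g
    fmap-id   : ∀ {X : Set ℓ} → fmap (id {A = X}) ≗ id
    fmap-∘    : ∀ {X Y Z : Set ℓ} (g : Y → Z) (f : X → Y) →
                fmap (g ∘ f) ≗ fmap g ∘ fmap f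
    η      : ∀ {X : Set ℓ} → X → F X
    μ      : ∀ {X : Set ℓ} → F (F X) → F X
    η-natural : ∀ {X Y : Set ℓ} (f : X → Y) → fmap f ∘ η ≗ η ∘ f
    μ-natural : ∀ {X Y : Set ℓ} (f : X → Y) → fmap f ∘ μ ≗ μ ∘ fmap (fmap f)
    unit-left  : ∀ {X : Set ℓ} → μ ∘ η {F X} ≗ id
    unit-right : ∀ {X : Set ℓ} → μ ∘ fmap (η {X}) ≗ id
    assoc      : ∀ {X : Set ℓ} → μ ∘ μ {F X} ≗ μ ∘ fmap (μ {X})

record NatTrans {ℓ : Level} (T S : Monad ℓ) : Set (suc ℓ) where
  private
    module T = Monad T
    module S = Monad S
  field
    component : ∀ {X : Set ℓ} → T.F (S.F X) → S.F (T.F X)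
    natural   : ∀ {X Y : Set ℓ} (f : X → Y) →
                S.fmap (T.fmap f) ∘ component ≗ component ∘ T.fmap (S.fmap f)

module Reader {ℓ : Level} (A : Set ℓ) where

  R : Set ℓ → Set ℓ
  R X = A → X

  Rmap : ∀ {X Y : Set ℓ} → (X → Y) → R X → R Y
  Rmap f h = f ∘ h

  ηR : ∀ {X : Set ℓ} → X → R X
  ηR x = λ _ → x

  μR : ∀ {X : Set ℓ} → R (R X) → R X
  μR h = λ a → h a a

  ev : ∀ {X : Set ℓ} → A → R X → X
  ev a h = h a

  ρ : (T : Monad ℓ) → ∀ {X : Set ℓ} → Monad.F T (R X) → R (Monad.F T X)
  ρ T z = λ a → Monad.fmap T (ev a) z

{-# OPTIONS --safe #-}
module Submission where

open import Defs
open import Level using (Level)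
open import Function using (_∘_)
open import Relation.Binary.PropositionalEquality using (_≡_; sym; cong; module ≡-Reasoning)

-- At a point a, evaluation â after ρ^M is just M â, so evaluating both sides at a
-- removes every ρ and leaves the naturality square of λ at the map â.

module _ {ℓ : Level} (A : Set ℓ) where
  open Reader A

  fmap-ev-∘-fmap-ρ : (S T : Monad ℓ) {X : Set ℓ} (a : A) →
                     Monad.fmap S (ev a) ∘ Monad.fmap S (ρ T {X})
                       ≗ Monad.fmap S (Monad.fmap T (ev a))
  fmap-ev-∘-fmap-ρ S T a = sym ∘ Monad.fmap-∘ S (ev a) (ρ T)

proposition4p12 : {ℓ : Level} (A : Set ℓ) (S T : Monad ℓ) (lam : NatTrans T S) (X : Set ℓ) →
                  let open Reader A in
                  (z : Monad.F T (Monad.F S (R X))) (a : A) →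
                  ρ S (Monad.fmap S (ρ T) (NatTrans.component lam z)) a
                    ≡ Rmap (NatTrans.component lam) (ρ T (Monad.fmap T (ρ S) z)) a
proposition4p12 A S T lam X z a = begin
  S.fmap (ev a) (S.fmap (ρ T) (lamT z))  ≡⟨ fmap-ev-∘-fmap-ρ A S T a (lamT z) ⟩
  S.fmap (T.fmap (ev a)) (lamT z)        ≡⟨ NatTrans.natural lam (ev a) z ⟩
  lamT (T.fmap (S.fmap (ev a)) z)        ≡⟨ cong lamT (sym (fmap-ev-∘-fmap-ρ A T S a z)) ⟩
  lamT (T.fmap (ev a) (T.fmap (ρ S) z))  ∎
  where
  open Reader A
  open ≡-Reasoning
  module S = Monad S
  module T = Monad T
  lamT : ∀ {Y} → T.F (S.F Y) → S.F (T.F Y)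
  lamT = NatTrans.component lam
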